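{- Let $G$ be a ONE-ONE-LQ instance in which a stable matching $M_s$ is feasible, let $s=|M_s|$, and let $G'$ be the instance obtained by the marking construction described in the context. If $M$ is a feasible, relaxed stable matching in $G$, then every edge of $M$ belongs to $G'$ and $M$ is a feasible, relaxed stable matching in $G'$.
   Context: ONE-ONE-LQ instance: bipartite graph $G=(\mathcal{A}\cup\mathcal{B},E)$ of agents and resources, each vertex with a strict preference order over its neighbours ($\succ_u$), each resource with upper-quota $1$ and lower-quota in $\{0,1\}$ (LQ resource if lower-quota $1$). Matching: each vertex in at most one edge; $M(v)$ partner or $\bot$ (least preferred). Feasible: every LQ resource matched. Blocking pair $(a,b)\in E\setminus M$: $b\succ_a M(a)$ and $a\succ_b M(b)$; stable: no blocking pair. Relaxed stable: every agent $a$ in a blocking pair is matched and $M(a)$ is an LQ resource. $\ell(v)$ = length of $v$'s list. Construction: let $X_A$ (resp. $X_B$) be the agents (resp. resources) matched in $M_s$. For every vertex $v\in X_A\cup X_B$, mark the $\min(2s+1,\ell(v))$ most preferred edges incident to $v$. $G'$ is the ONE-ONE-LQ instance formed by the marked edges and their endpoints, with the same quotas and preference lists of $G$ restricted to neighbours in $G'$. -}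

module Defs where

open import Data.Nat using (ℕ; suc; _+_; _*_)
open import Data.Fin using (Fin; _≟_)
open import Data.Bool using (Bool; true; false; _∧_; _∨_; not; T)
open import Data.List using (List; []; _∷_; _++_; length; take; filterᵇ; null)
open import Data.Bool.ListAction using (any)
open import Data.List.Membership.Propositional using (_∈_; _∉_)
open import Data.List.Relation.Unary.Unique.Propositional using (Unique)
open import Data.Product using (_×_; _,_; ∃; ∃₂; proj₁; proj₂)
open import Relation.Binary.PropositionalEquality using (_≡_)
open import Relation.Nullary using (¬_)
open import Relation.Nullary.Decidable using (⌊_⌋)

-- A ONE-ONE-LQ instance with agents Fin nA and resources Fin nB.
-- prefA a : preference list of agent a (most preferred first), prefB b likewise.
-- lq b ≡ true  iff resource b has lower quota 1 (an LQ resource).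
-- Upper quotas are all 1 (built into the notion of matching below).
record Instance (nA nB : ℕ) : Set where
  field
    prefA : Fin nA → List (Fin nB)
    prefB : Fin nB → List (Fin nA)
    lq    : Fin nB → Bool
open Instance public

WellFormed : ∀ {nA nB} → Instance nA nB → Set
WellFormed G =
  (∀ a → Unique (prefA G a)) × (∀ b → Unique (prefB G b)) ×
  (∀ a b → b ∈ prefA G a → a ∈ prefB G b) × (∀ a b → a ∈ prefB G b → b ∈ prefA G a)

Edge : ∀ {nA nB} → Instance nA nB → Fin nA → Fin nB → Set
Edge G a b = b ∈ prefA G a × a ∈ prefB G b

Before : ∀ {A : Set} → List A → A → A → Set
Before {A} xs x y = ∃₂ λ (ys zs : List A) → (xs ≡ ys ++ (x ∷ zs)) × (y ∈ zs)

Matching : ℕ → ℕ → Set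
Matching nA nB = List (Fin nA × Fin nB)

IsMatching : ∀ {nA nB} → Instance nA nB → Matching nA nB → Set
IsMatching G M =
  Unique M ×
  (∀ a b → (a , b) ∈ M → Edge G a b) ×
  (∀ a b b′ → (a , b) ∈ M → (a , b′) ∈ M → b ≡ b′) ×
  (∀ a a′ b → (a , b) ∈ M → (a′ , b) ∈ M → a ≡ a′)

-- b ≻_a M(a)   (M(a) = ⊥ is least preferred)
PrefersA : ∀ {nA nB} → Instance nA nB → Matching nA nB → Fin nA → Fin nB → Set
PrefersA G M a b = ∀ b′ → (a , b′) ∈ M → Before (prefA G a) b b′

PrefersB : ∀ {nA nB} → Instance nA nB → Matching nA nB → Fin nB → Fin nA → Set
PrefersB G M b a = ∀ a′ → (a′ , b) ∈ M → Before (prefB G b) a a′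

BlockingPair : ∀ {nA nB} → Instance nA nB → Matching nA nB → Fin nA → Fin nB → Set
BlockingPair G M a b =
  Edge G a b × (a , b) ∉ M × PrefersA G M a b × PrefersB G M b a

Stable : ∀ {nA nB} → Instance nA nB → Matching nA nB → Set
Stable G M = ∀ a b → ¬ BlockingPair G M a b

Feasible : ∀ {nA nB} → Instance nA nB → Matching nA nB → Set
Feasible G M = ∀ b → lq G b ≡ true → ∃ λ a → (a , b) ∈ M

RelaxedStable : ∀ {nA nB} → Instance nA nB → Matching nA nB → Set
RelaxedStable G M =
  ∀ a b → BlockingPair G M a b → ∃ λ b′ → ((a , b′) ∈ M) × (lq G b′ ≡ true)

_∈ᵇ_ : ∀ {n} → Fin n → List (Fin n) → Bool
x ∈ᵇ xs = any (λ y → ⌊ x ≟ y ⌋) xs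

inXA : ∀ {nA nB} → Matching nA nB → Fin nA → Bool
inXA Ms a = any (λ e → ⌊ proj₁ e ≟ a ⌋) Ms

inXB : ∀ {nA nB} → Matching nA nB → Fin nB → Bool
inXB Ms b = any (λ e → ⌊ proj₂ e ≟ b ⌋) Ms

marked : ∀ {nA nB} → Instance nA nB → Matching nA nB → Fin nA → Fin nB → Bool
marked G Ms a b =
  (inXA Ms a ∧ (b ∈ᵇ take (suc (2 * length Ms)) (prefA G a))) ∨
  (inXB Ms b ∧ (a ∈ᵇ take (suc (2 * length Ms)) (prefB G b)))

-- Vertices not incident to a marked edge are not in G′; they are represented
-- by empty lists, and a resource not in G′ gets lower quota 0.
reduced : ∀ {nA nB} → Instance nA nB → Matching nA nB → Instance nA nB
reduced G Ms = record
  { prefA = λ a → filterᵇ (λ b → marked G Ms a b) (prefA G a)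
  ; prefB = λ b → filterᵇ (λ a → marked G Ms a b) (prefB G b)
  ; lq    = λ b → lq G b ∧ not (null (filterᵇ (λ a → marked G Ms a b) (prefB G b)))
  }

{-# OPTIONS --safe #-}
-- An edge (a , b) of M is marked from b's side if b is matched in Ms, and from a's side otherwise
-- (then a is matched in Ms, as Ms is stable).  In both cases each rival ranked above the M-partner
-- is charged injectively to one of 2s slots: an Ms-edge at the rival itself, or an Ms-edge at the
-- rival's M-partner.  Relaxed stability of M (with feasibility of Ms on a's side, where b is not
-- LQ) forces every rival to be matched in M, and stability of Ms forces every M-edge to touch a
-- vertex matched in Ms.  So the M-partner sits at position at
-- most 2s+1.  The remaining claims hold because G′ keeps the lists of G in order.
module Submission where

open import Defs
open import Data.Nat using (ℕ; suc; _+_; _*_)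
open import Data.Nat.Properties using (+-identityʳ)
open import Data.Fin using (Fin; _≟_)
open import Data.Bool using (Bool; true; false; _∧_; not; T)
open import Data.Bool.Properties using (T-∧; T-∨)
open import Data.Bool.ListAction using (any)
open import Data.List using (List; []; _∷_; [_]; _++_; length; take; filterᵇ; null; map)
open import Data.List.Properties using (length-++; length-map; length-removeAt′)
open import Data.List.Membership.Propositional using (_∈_; _─_; find)
open import Data.List.Membership.Propositional.Properties using (∈-++⁺ˡ; ∈-++⁺ʳ; ∈-map⁺; ∈-filter⁺; ∈-filter⁻)
open import Data.List.Relation.Unary.Any as Any using (Any; here; there; any?)
open import Data.List.Relation.Unary.Any.Properties using (any⁺)
open import Data.List.Relation.Unary.All as All using ()
open import Data.List.Relation.Unary.AllPairs using (_∷_)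
open import Data.List.Relation.Unary.Unique.Propositional using (Unique)
open import Data.List.Relation.Binary.Sublist.Propositional using (_⊆_; _∷_; _∷ʳ_; ⊆-trans; from∈; to∈)
open import Data.List.Relation.Binary.Sublist.Propositional.Properties using (++⁺ˡ; filter-⊆)
open import Data.Product using (_×_; _,_; ∃-syntax; proj₁; proj₂)
open import Data.Sum using (_⊎_; inj₁; inj₂)
open import Data.Empty using (⊥-elim)
open import Function using (_∘_; Equivalence)
open import Relation.Binary.PropositionalEquality using (_≡_; _≢_; refl; sym; cong; cong₂; subst; module ≡-Reasoning)
open import Relation.Nullary using (¬_; Dec; yes; no)
open import Relation.Nullary.Decidable using (⌊_⌋; map′; fromWitness; T?)

private
  variable
    A B : Set
    x y z : A
    xs K : List A

∷-Before : ∀ w → Before xs x y → Before (w ∷ xs) x y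
∷-Before w (ys , zs , refl , y∈zs) = w ∷ ys , zs , refl , y∈zs

Before⇒∈ : Before xs x y → x ∈ xs
Before⇒∈ (ys , _ , refl , _) = ∈-++⁺ʳ ys (here refl)

Before⇒⊆ : Before xs x y → x ∷ [ y ] ⊆ xs
Before⇒⊆ (ys , _ , refl , y∈zs) = ++⁺ˡ ys (refl ∷ from∈ y∈zs)

⊆⇒Before : x ∷ [ y ] ⊆ xs → Before xs x y
⊆⇒Before (w ∷ʳ τ)  = ∷-Before w (⊆⇒Before τ)
⊆⇒Before (refl ∷ τ) = [] , _ , refl , to∈ τ

Before-filterᵇ⁻ : (p : A → Bool) → Before (filterᵇ p xs) x y → Before xs x y
Before-filterᵇ⁻ {xs = xs} p x<y = ⊆⇒Before (⊆-trans (Before⇒⊆ x<y) (filter-⊆ (T? ∘ p) xs))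

∈-─⁺ : (z∈K : z ∈ K) → y ∈ K → y ≢ z → y ∈ K ─ z∈K
∈-─⁺ (here refl) (here refl) y≢z = ⊥-elim (y≢z refl)
∈-─⁺ (here refl) (there y∈K)  _   = y∈K
∈-─⁺ (there _)   (here refl) _   = here refl
∈-─⁺ (there z∈K) (there y∈K) y≢z = there (∈-─⁺ z∈K y∈K y≢z)

module _ (R : A → B → Set) (R-injective : ∀ {x x′ z} → R x z → R x′ z → x ≡ x′) where

  ∈-take-if-predecessors-charged : ∀ (K : List B) → Unique xs → x ∈ xs →
    (∀ {y} → Before xs y x → ∃[ z ] z ∈ K × R y z) → x ∈ take (suc (length K)) xs
  ∈-take-if-predecessors-charged K u (here refl) charge = here refl
  ∈-take-if-predecessors-charged {xs = w ∷ xs} {x} K (w∉xs ∷ u) (there x∈xs) charge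
    with z , z∈K , wRz ← charge ([] , xs , refl , x∈xs) =
    subst (λ n → x ∈ take (suc n) (w ∷ xs)) (sym (length-removeAt′ K (Any.index z∈K)))
      (there (∈-take-if-predecessors-charged (K ─ z∈K) u x∈xs charge′))
    where
    charge′ : ∀ {y} → Before xs y x → ∃[ z′ ] z′ ∈ K ─ z∈K × R y z′
    charge′ y<x with z′ , z′∈K , yRz′ ← charge (∷-Before w y<x) =
      z′ , ∈-─⁺ z∈K z′∈K (λ { refl → All.lookup w∉xs (Before⇒∈ y<x) (R-injective wRz yRz′) }) , yRz′

T-any : (p : A → Bool) → x ∈ xs → T (p x) → T (any p xs)
T-any p x∈xs px = any⁺ p (Any.map (λ { refl → px }) x∈xs)

T-∈ᵇ : ∀ {n} {i : Fin n} {is} → i ∈ is → T (i ∈ᵇ is)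
T-∈ᵇ i∈is = T-any _ i∈is (fromWitness refl)

∈⇒null≡false : x ∈ xs → null xs ≡ false
∈⇒null≡false (here _)  = refl
∈⇒null≡false (there _) = refl

∧≡true⇒ˡ : ∀ b {c} → b ∧ c ≡ true → b ≡ true
∧≡true⇒ˡ true _ = refl

module _ {nA nB : ℕ} where

  Matchedᴬ : Matching nA nB → Fin nA → Set
  Matchedᴬ M a = ∃[ b ] (a , b) ∈ M

  Matchedᴮ : Matching nA nB → Fin nB → Set
  Matchedᴮ M b = ∃[ a ] (a , b) ∈ M

  matchedᴬ? : ∀ M a → Dec (Matchedᴬ M a)
  matchedᴬ? M a = map′ found (λ (b , ab) → Any.map (cong proj₁) ab) (any? (λ e → a ≟ proj₁ e) M)
    where
    found : Any (λ e → a ≡ proj₁ e) M → Matchedᴬ M a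
    found p with (_ , b) , e∈M , refl ← find p = b , e∈M

  matchedᴮ? : ∀ M b → Dec (Matchedᴮ M b)
  matchedᴮ? M b = map′ found (λ (a , ab) → Any.map (cong proj₂) ab) (any? (λ e → b ≟ proj₂ e) M)
    where
    found : Any (λ e → b ≡ proj₂ e) M → Matchedᴮ M b
    found p with (a , _) , e∈M , refl ← find p = a , e∈M

  inXA⁺ : ∀ {Ms : Matching nA nB} {a b} → (a , b) ∈ Ms → T (inXA Ms a)
  inXA⁺ {a = a} ab = T-any (λ e → ⌊ proj₁ e ≟ a ⌋) ab (fromWitness refl)

  inXB⁺ : ∀ {Ms : Matching nA nB} {a b} → (a , b) ∈ Ms → T (inXB Ms b)
  inXB⁺ {b = b} ab = T-any (λ e → ⌊ proj₂ e ≟ b ⌋) ab (fromWitness refl)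

  module _ {G : Instance nA nB} {M : Matching nA nB} where

    unmatched⇒prefersᴬ : ∀ {a b} → ¬ Matchedᴬ M a → PrefersA G M a b
    unmatched⇒prefersᴬ ¬a b′ ab′ = ⊥-elim (¬a (b′ , ab′))

    unmatched⇒prefersᴮ : ∀ {a b} → ¬ Matchedᴮ M b → PrefersB G M b a
    unmatched⇒prefersᴮ ¬b a′ a′b = ⊥-elim (¬b (a′ , a′b))

    before-partner⇒prefersᴬ : ∀ {a b b₀} → IsMatching G M → (a , b₀) ∈ M →
      Before (prefA G a) b b₀ → PrefersA G M a b
    before-partner⇒prefersᴬ (_ , _ , functional , _) ab₀ b<b₀ b′ ab′ =
      subst (Before _ _) (functional _ _ _ ab₀ ab′) b<b₀

    before-partner⇒prefersᴮ : ∀ {a a₀ b} → IsMatching G M → (a₀ , b) ∈ M →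
      Before (prefB G b) a a₀ → PrefersB G M b a
    before-partner⇒prefersᴮ (_ , _ , _ , injective) a₀b a<a₀ a′ a′b =
      subst (Before _ _) (injective _ _ _ a₀b a′b) a<a₀

    stable⇒edge-covered : ∀ {a b} → Stable G M → Edge G a b → Matchedᴬ M a ⊎ Matchedᴮ M b
    stable⇒edge-covered {a} {b} stable e with matchedᴬ? M a | matchedᴮ? M b
    ... | yes ma | _      = inj₁ ma
    ... | no _   | yes mb = inj₂ mb
    ... | no ¬a  | no ¬b  = ⊥-elim (stable a b
          (e , (λ ab → ¬a (b , ab)) , unmatched⇒prefersᴬ ¬a , unmatched⇒prefersᴮ ¬b))

    -- A rival of an M-partner left unmatched in M would block M; relaxed stability then forces it
    -- to be matched (agent side), or the partner to be an LQ resource (resource side).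
    relaxed⇒rivalᴬ-matched : ∀ {a b y} → WellFormed G → IsMatching G M → RelaxedStable G M →
      (a , b) ∈ M → Before (prefB G b) y a → Matchedᴬ M y
    relaxed⇒rivalᴬ-matched {a} {b} {y} (_ , _ , _ , symᴮ) mM relaxed ab y<a with matchedᴬ? M y
    ... | yes my = my
    ... | no ¬y with b′ , yb′ , _ ← relaxed y b
          ((symᴮ y b (Before⇒∈ y<a) , Before⇒∈ y<a) , (λ yb → ¬y (b , yb)) ,
           unmatched⇒prefersᴬ ¬y , before-partner⇒prefersᴮ mM ab y<a) = b′ , yb′

    relaxed⇒rivalᴮ-matched : ∀ {a b y} → WellFormed G → IsMatching G M → RelaxedStable G M →
      (a , b) ∈ M → lq G b ≢ true → Before (prefA G a) y b → Matchedᴮ M y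
    relaxed⇒rivalᴮ-matched {a} {b} {y} (_ , _ , symᴬ , _) mM relaxed ab ¬lq y<b with matchedᴮ? M y
    ... | yes my = my
    ... | no ¬y with b′ , ab′ , lqb′ ← relaxed a y
          ((Before⇒∈ y<b , symᴬ a y (Before⇒∈ y<b)) , (λ ay → ¬y (a , ay)) ,
           before-partner⇒prefersᴬ mM ab y<b , unmatched⇒prefersᴮ ¬y) =
      ⊥-elim (¬lq (subst (λ c → lq G c ≡ true) (proj₁ (proj₂ (proj₂ mM)) a b′ b ab′ ab) lqb′))

module Reduced {nA nB : ℕ} (G : Instance nA nB) (Ms M : Matching nA nB) where

  G′ : Instance nA nB
  G′ = reduced G Ms

  edge⁺ : ∀ {a b} → Edge G a b → T (marked G Ms a b) → Edge G′ a b
  edge⁺ {a} {b} (b∈a , a∈b) m =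
    ∈-filter⁺ (T? ∘ marked G Ms a) b∈a m , ∈-filter⁺ (T? ∘ λ a′ → marked G Ms a′ b) a∈b m

  blocking⁻ : ∀ {a b} → BlockingPair G′ M a b → BlockingPair G M a b
  blocking⁻ {a} {b} ((b∈a , a∈b) , ab∉M , prefersᴬ , prefersᴮ) =
    (proj₁ (∈-filter⁻ (T? ∘ _) b∈a) , proj₁ (∈-filter⁻ (T? ∘ _) a∈b)) , ab∉M ,
    (λ b′ ab′ → Before-filterᵇ⁻ _ (prefersᴬ b′ ab′)) , (λ a′ a′b → Before-filterᵇ⁻ _ (prefersᴮ a′ a′b))

  isMatching⁺ : IsMatching G M → (∀ a b → (a , b) ∈ M → Edge G′ a b) → IsMatching G′ M
  isMatching⁺ (unique , _ , functional , injective) edges = unique , edges , functional , injective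

  feasible⁺ : Feasible G M → Feasible G′ M
  feasible⁺ feasible b lq′ = feasible b (∧≡true⇒ˡ (lq G b) lq′)

  relaxedStable⁺ : (∀ a b → (a , b) ∈ M → Edge G′ a b) → RelaxedStable G M → RelaxedStable G′ M
  relaxedStable⁺ edges relaxed a b blocking with b′ , ab′ , lqb′ ← relaxed a b (blocking⁻ blocking) =
    b′ , ab′ , cong₂ (λ l n → l ∧ not n) lqb′ (∈⇒null≡false (proj₂ (edges a b′ ab′)))

module Marking {nA nB : ℕ} (G : Instance nA nB) (Ms M : Matching nA nB) (wf : WellFormed G)
  (stableMs : Stable G Ms) (feasibleMs : Feasible G Ms)
  (mM : IsMatching G M) (relaxedM : RelaxedStable G M) where

  Slot : Set
  Slot = Fin nA × Fin nB ⊎ Fin nA × Fin nB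

  slots : List Slot
  slots = map inj₁ Ms ++ map inj₂ Ms

  length-slots : length slots ≡ 2 * length Ms
  length-slots = begin
    length (map inj₁ Ms ++ map inj₂ Ms)          ≡⟨ length-++ (map inj₁ Ms) ⟩
    length (map inj₁ Ms) + length (map inj₂ Ms)  ≡⟨ cong₂ _+_ (length-map inj₁ Ms) (length-map inj₂ Ms) ⟩
    length Ms + length Ms                        ≡⟨ cong (length Ms +_) (sym (+-identityʳ (length Ms))) ⟩
    2 * length Ms                                ∎
    where open ≡-Reasoning

  ChargedAgent : Fin nA → Slot → Set
  ChargedAgent y (inj₁ (a , _)) = a ≡ y
  ChargedAgent y (inj₂ (_ , b)) = (y , b) ∈ M

  ChargedResource : Fin nB → Slot → Set
  ChargedResource y (inj₁ (_ , b)) = b ≡ y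
  ChargedResource y (inj₂ (a , _)) = (a , y) ∈ M

  chargedAgent-injective : ∀ {y y′ z} → ChargedAgent y z → ChargedAgent y′ z → y ≡ y′
  chargedAgent-injective {z = inj₁ _} refl refl = refl
  chargedAgent-injective {z = inj₂ _} yb y′b = proj₂ (proj₂ (proj₂ mM)) _ _ _ yb y′b

  chargedResource-injective : ∀ {y y′ z} → ChargedResource y z → ChargedResource y′ z → y ≡ y′
  chargedResource-injective {z = inj₁ _} refl refl = refl
  chargedResource-injective {z = inj₂ _} ay ay′ = proj₁ (proj₂ (proj₂ mM)) _ _ _ ay ay′

  edgeM : ∀ {a b} → (a , b) ∈ M → Edge G a b
  edgeM = proj₁ (proj₂ mM) _ _

  chargeAgent : ∀ {y b} → (y , b) ∈ M → ∃[ z ] z ∈ slots × ChargedAgent y z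
  chargeAgent {y} {b} yb with stable⇒edge-covered {G = G} {M = Ms} stableMs (edgeM yb)
  ... | inj₁ (c , yc) = inj₁ (y , c) , ∈-++⁺ˡ (∈-map⁺ inj₁ yc) , refl
  ... | inj₂ (a , ab) = inj₂ (a , b) , ∈-++⁺ʳ (map inj₁ Ms) (∈-map⁺ inj₂ ab) , yb

  chargeResource : ∀ {a y} → (a , y) ∈ M → ∃[ z ] z ∈ slots × ChargedResource y z
  chargeResource {a} {y} ay with stable⇒edge-covered {G = G} {M = Ms} stableMs (edgeM ay)
  ... | inj₁ (b , ab) = inj₂ (a , b) , ∈-++⁺ʳ (map inj₁ Ms) (∈-map⁺ inj₂ ab) , ay
  ... | inj₂ (c , cy) = inj₁ (c , y) , ∈-++⁺ˡ (∈-map⁺ inj₁ cy) , refl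

  partner-rankedᴮ : ∀ {a b} → (a , b) ∈ M → a ∈ take (suc (2 * length Ms)) (prefB G b)
  partner-rankedᴮ {a} {b} ab =
    subst (λ n → a ∈ take (suc n) (prefB G b)) length-slots
      (∈-take-if-predecessors-charged ChargedAgent chargedAgent-injective slots
        (proj₁ (proj₂ wf) b) (proj₂ (edgeM ab))
        (λ y<a → chargeAgent (proj₂ (relaxed⇒rivalᴬ-matched wf mM relaxedM ab y<a))))

  partner-rankedᴬ : ∀ {a b} → (a , b) ∈ M → ¬ Matchedᴮ Ms b →
    b ∈ take (suc (2 * length Ms)) (prefA G a)
  partner-rankedᴬ {a} {b} ab ¬b =
    subst (λ n → b ∈ take (suc n) (prefA G a)) length-slots
      (∈-take-if-predecessors-charged ChargedResource chargedResource-injective slots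
        (proj₁ wf a) (proj₁ (edgeM ab))
        (λ y<b → chargeResource
          (proj₂ (relaxed⇒rivalᴮ-matched wf mM relaxedM ab (¬b ∘ feasibleMs b) y<b))))

  matching-edge-marked : ∀ {a b} → (a , b) ∈ M → T (marked G Ms a b)
  matching-edge-marked {a} {b} ab with matchedᴮ? Ms b
  ... | yes (_ , a₀b) =
    Equivalence.from T-∨ (inj₂ (Equivalence.from T-∧ (inXB⁺ a₀b , T-∈ᵇ (partner-rankedᴮ ab))))
  ... | no ¬b with stable⇒edge-covered {G = G} {M = Ms} stableMs (edgeM ab)
  ...   | inj₁ (_ , ac) =
    Equivalence.from T-∨ (inj₁ (Equivalence.from T-∧ (inXA⁺ ac , T-∈ᵇ (partner-rankedᴬ ab ¬b))))
  ...   | inj₂ mb = ⊥-elim (¬b mb)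

lemma6 : ∀ {nA nB : ℕ} (G : Instance nA nB) (Ms M : Matching nA nB) →
    WellFormed G →
    IsMatching G Ms → Stable G Ms → Feasible G Ms →
    IsMatching G M → Feasible G M → RelaxedStable G M →
    (∀ a b → (a , b) ∈ M → Edge (reduced G Ms) a b) ×
    IsMatching (reduced G Ms) M × Feasible (reduced G Ms) M × RelaxedStable (reduced G Ms) M
lemma6 G Ms M wf _ stableMs feasibleMs mM feasibleM relaxedM =
  edges , isMatching⁺ mM edges , feasible⁺ feasibleM , relaxedStable⁺ edges relaxedM
  where
  open Reduced G Ms M
  open Marking G Ms M wf stableMs feasibleMs mM relaxedM

  edges : ∀ a b → (a , b) ∈ M → Edge (reduced G Ms) a b
  edges a b ab = edge⁺ (edgeM ab) (matching-edge-marked ab)
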